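{- For every alternating pushdown system $\mathcal I_0$ there exists a small step alternating pushdown system $\mathcal I$ that is a conservative extension of $\mathcal I_0$: the language of $\mathcal I$ is obtained from that of $\mathcal I_0$ by adding finitely many new states (with the same stack symbols), every rule of $\mathcal I_0$ is derivable in $\mathcal I$, and a configuration in the language of $\mathcal I_0$ is provable in $\mathcal I$ if and only if it is provable in $\mathcal I_0$.
   Context: Fix a first-order language with finitely many unary predicate symbols (states), finitely many unary function symbols (stack symbols), one constant $\varepsilon$, and a variable $x$. A word is a closed term $\gamma_1(\cdots\gamma_n(\varepsilon))$ ($n\ge0$), written $\gamma_1\cdots\gamma_n$; $wx$ denotes $\gamma_1(\cdots\gamma_n(x))$ for $w=\gamma_1\cdots\gamma_n$. A configuration is an atomic proposition $P(w)$ with $P$ a state and $w$ a word. An alternating pushdown system is a finite set of inference rules, each either of the form $\frac{P_1(v_1x)\ \cdots\ P_n(v_nx)}{Q(wx)}$ ($n\ge0$, $v_i,w$ words) or of the form $\frac{}{Q(\varepsilon)}$. A proof of a configuration $A$ in a set of rules is a finite tree labeled by configurations with root $A$ such that each node is labeled $\sigma B$ and its children $\sigma A_1,\dots,\sigma A_n$ for some rule $\frac{A_1\cdots A_n}{B}$ of the system and some substitution $\sigma$ of a word for $x$; a configuration is provable if it has a proof. An introduction rule is a rule $\frac{P_1(x)\cdots P_n(x)}{Q(\gamma x)}$ ($\gamma$ a stack symbol, $n\ge0$) or $\frac{}{Q(\varepsilon)}$; an elimination rule is a rule $\frac{P_1(\gamma x)\ P_2(x)\cdots P_n(x)}{Q(x)}$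 ($\gamma$ a stack symbol, $n\ge1$); a neutral rule is a rule $\frac{P_1(x)\cdots P_n(x)}{Q(x)}$ ($n\ge0$). A small step alternating pushdown system is an alternating pushdown system all of whose rules are introduction, elimination or neutral rules. -}

module Defs where

open import Data.Nat using (ℕ)
open import Data.Fin using (Fin)
open import Data.Bool using (Bool; true; false)
open import Data.List using (List; []; _∷_; _++_; map)
open import Data.List.Relation.Unary.All using (All)
open import Data.List.Membership.Propositional using (_∈_)
open import Data.Product using (Σ; _×_; _,_; proj₁; proj₂)
open import Data.Sum using (_⊎_)
open import Relation.Binary.PropositionalEquality using (_≡_)

-- Words over stack symbols S: γ₁ ⋯ γₙ is the list [γ₁, …, γₙ];
-- the term w x is (w ++ u) after substituting the word u for x.
Word : Set → Set
Word S = List S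

Config : Set → Set → Set
Config P S = P × Word S

-- Inference rules of an alternating pushdown system.
--   open-rule prems Q w   represents   P₁(v₁x) ⋯ Pₙ(vₙx) / Q(wx)
--     where prems = [(P₁,v₁), …, (Pₙ,vₙ)]
--   eps-rule Q            represents   / Q(ε)
data Rule (P S : Set) : Set where
  open-rule : List (P × Word S) → P → Word S → Rule P S
  eps-rule  : P → Rule P S

APDS : Set → Set → Set
APDS P S = List (Rule P S)

data Provable {P S : Set} (R : APDS P S) : Config P S → Set where
  app-open : ∀ {prems Q w} → open-rule prems Q w ∈ R → (u : Word S) →
             All (λ pv → Provable R (proj₁ pv , proj₂ pv ++ u)) prems →
             Provable R (Q , w ++ u)
  app-eps  : ∀ {Q} → eps-rule Q ∈ R → Provable R (Q , [])

AllEmpty : {P S : Set} → List (P × Word S) → Set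
AllEmpty prems = All (λ pv → proj₂ pv ≡ []) prems

data Introduction {P S : Set} : Rule P S → Set where
  intro-push : ∀ {prems Q γ} → AllEmpty prems → Introduction (open-rule prems Q (γ ∷ []))
  intro-eps  : ∀ {Q} → Introduction (eps-rule Q)

data Elimination {P S : Set} : Rule P S → Set where
  elim : ∀ {P₁ γ prems Q} → AllEmpty prems →
         Elimination (open-rule ((P₁ , γ ∷ []) ∷ prems) Q [])

data Neutral {P S : Set} : Rule P S → Set where
  neutral : ∀ {prems Q} → AllEmpty prems → Neutral (open-rule prems Q [])

SmallStep : {P S : Set} → APDS P S → Set
SmallStep R = All (λ r → Introduction r ⊎ Elimination r ⊎ Neutral r) R

-- Open terms: (v , true) is v x, (v , false) is the closed word v.
Term : Set → Set
Term S = Word S × Bool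

_[_] : {S : Set} → Term S → Term S → Term S
(v , false) [ t ] = (v , false)
(v , true)  [ t ] = (v ++ proj₁ t , proj₂ t)

data Deriv {P S : Set} (R : APDS P S) (H : List (P × Term S)) : P × Term S → Set where
  hyp      : ∀ {A} → A ∈ H → Deriv R H A
  app-open : ∀ {prems Q w} → open-rule prems Q w ∈ R → (σ : Term S) →
             All (λ pv → Deriv R H (proj₁ pv , (proj₂ pv , true) [ σ ])) prems →
             Deriv R H (Q , (w , true) [ σ ])
  app-eps  : ∀ {Q} → eps-rule Q ∈ R → Deriv R H (Q , ([] , false))

Derivable : {P S : Set} → APDS P S → Rule P S → Set
Derivable R (open-rule prems Q w) =
  Deriv R (map (λ pv → (proj₁ pv , (proj₂ pv , true))) prems) (Q , (w , true))
Derivable R (eps-rule Q) = Deriv R [] (Q , ([] , false))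

mapRule : {P P' S : Set} → (P → P') → Rule P S → Rule P' S
mapRule f (open-rule prems Q w) = open-rule (map (λ pv → (f (proj₁ pv) , proj₂ pv)) prems) (f Q) w
mapRule f (eps-rule Q) = eps-rule (f Q)

module Submission where

-- Idea: a pattern X(v x) occurring in a rule of I₀ is simulated by a fresh state
-- ⟨X,v⟩ meaning "X(v y)"; for every non-empty prefix a ++ [δ] of v we add the
-- introduction rule ⟨X,a++[δ]⟩(x) / ⟨X,a⟩(δ x) and the elimination rule
-- ⟨X,a⟩(δ x) / ⟨X,a++[δ]⟩(x), which together move δ between stack and state
-- (⟨X,[]⟩ is X itself). Each rule of I₀ becomes a neutral rule on these states.

open import Defs
open import Data.Nat using (ℕ)
open import Data.Fin using (Fin)
open import Data.List using (List)
open import Data.List.Relation.Unary.All using (All)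
open import Data.Product using (Σ; _×_; _,_)
open import Data.Sum using (_⊎_; inj₁)
open import Function.Bundles using (_⇔_)

open import Data.Bool using (true; false)
open import Data.Empty using (⊥-elim)
open import Data.Fin.Properties using () renaming (_≟_ to _≟Fin_)
open import Data.List using ([]; _∷_; _++_; map; concatMap; length; lookup)
open import Data.List.Membership.Propositional using (_∈_; lose)
open import Data.List.Membership.Propositional.Properties using (∈-map⁺; ∈-concatMap⁺)
open import Data.List.Properties using (++-assoc; ++-identityʳ)
import Data.List.Properties as List
open import Data.List.Relation.Binary.Subset.Propositional using (_⊆_)
open import Data.List.Relation.Unary.All using ([]; _∷_)
import Data.List.Relation.Unary.All as All
import Data.List.Relation.Unary.All.Properties as All
open import Data.List.Relation.Unary.Any using (here; there; index)
open import Data.List.Relation.Unary.Any.Properties using (lookup-index; ++⁺ˡ; ++⁺ʳ)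
open import Data.Product using (proj₁; proj₂)
import Data.Product.Properties as Product
open import Data.Sum using (inj₂)
open import Function using (id)
open import Function.Bundles using (mk⇔)
open import Relation.Binary.Definitions using (DecidableEquality)
open import Relation.Binary.PropositionalEquality using (_≡_; refl; sym; cong; subst; module ≡-Reasoning)
open import Relation.Nullary using (yes; no)

module _ {P S : Set} where

  close : Term S → Word S → Word S
  close (v , true)  u = v ++ u
  close (v , false) u = v

  close-[] : (v : Word S) (σ : Term S) (u : Word S) →
             close ((v , true) [ σ ]) u ≡ v ++ close σ u
  close-[] v (w , true)  u = ++-assoc v w u
  close-[] v (w , false) u = refl

  module _ (R : APDS P S) {H : List (P × Term S)} (u : Word S)
           (hs : All (λ h → Provable R (proj₁ h , close (proj₂ h) u)) H) where
    mutual
      close-deriv : ∀ {A} → Deriv R H A → Provable R (proj₁ A , close (proj₂ A) u)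
      close-deriv (hyp m) = All.lookup hs m
      close-deriv (app-open {Q = Y} {w} m σ ds) =
        subst (λ z → Provable R (Y , z)) (sym (close-[] w σ u))
              (app-open m (close σ u) (close-premises σ ds))
      close-deriv (app-eps m) = app-eps m

      close-premises : ∀ {prems} (σ : Term S) →
        All (λ pv → Deriv R H (proj₁ pv , (proj₂ pv , true) [ σ ])) prems →
        All (λ pv → Provable R (proj₁ pv , proj₂ pv ++ close σ u)) prems
      close-premises σ [] = []
      close-premises {(X , v) ∷ _} σ (d ∷ ds) =
        subst (λ z → Provable R (X , z)) (close-[] v σ u) (close-deriv d) ∷ close-premises σ ds

  Closed : (M : P → Word S → Set) → Rule P S → Set
  Closed M (open-rule prems Y w) =
    ∀ u → All (λ pv → M (proj₁ pv) (proj₂ pv ++ u)) prems → M Y (w ++ u)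
  Closed M (eps-rule Y) = M Y []

  module _ (M : P → Word S → Set) {R : APDS P S} (closed : All (Closed M) R) where
    mutual
      sound : ∀ {c} → Provable R c → M (proj₁ c) (proj₂ c)
      sound (app-open m u ps) = All.lookup closed m u (sound-premises ps)
      sound (app-eps m)       = All.lookup closed m

      sound-premises : ∀ {prems u} → All (λ pv → Provable R (proj₁ pv , proj₂ pv ++ u)) prems →
                       All (λ pv → M (proj₁ pv) (proj₂ pv ++ u)) prems
      sound-premises []       = []
      sound-premises (p ∷ ps) = sound p ∷ sound-premises ps

all-concatMap : {A B : Set} {Q : B → Set} (f : A → List B) (xs : List A) →
                (∀ {t} → t ∈ xs → All Q (f t)) → All Q (concatMap f xs)
all-concatMap f xs h = All.concat⁺ (All.map⁺ (All.tabulate h))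

module _ {P P′ S : Set} (f : P → P′) {R₀ : APDS P S} {R : APDS P′ S}
         (derivable : All (λ r → Derivable R (mapRule f r)) R₀) where
  mutual
    derivable⇒admissible : ∀ {c} → Provable R₀ c → Provable R (f (proj₁ c) , proj₂ c)
    derivable⇒admissible (app-open m u ps) =
      close-deriv R u (All.map⁺ (All.map⁺ (admissible-premises ps))) (All.lookup derivable m)
    derivable⇒admissible (app-eps m) = close-deriv R [] [] (All.lookup derivable m)

    admissible-premises : ∀ {prems u} → All (λ pv → Provable R₀ (proj₁ pv , proj₂ pv ++ u)) prems →
                          All (λ pv → Provable R (f (proj₁ pv) , proj₂ pv ++ u)) prems
    admissible-premises []       = []
    admissible-premises (p ∷ ps) = derivable⇒admissible p ∷ admissible-premises ps

module SmallStepTranslation {P S : Set} (_≟P_ : DecidableEquality P) (_≟S_ : DecidableEquality S)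
                            (I₀ : APDS P S) where

  -- A pattern (X , v) stands for X(v x); the state ⟨X,v⟩ will stand for it.
  Pattern : Set
  Pattern = P × Word S

  _≟_ : DecidableEquality Pattern
  _≟_ = Product.≡-dec _≟P_ (List.≡-dec _≟S_)

  open import Data.List.Membership.DecPropositional _≟_ using (_∈?_)

  patterns : Rule P S → List Pattern
  patterns (open-rule prems Y w) = (Y , w) ∷ prems
  patterns (eps-rule Y)          = []

  Patterns : List Pattern
  Patterns = concatMap patterns I₀

  extensions : P → Word S → Word S → List Pattern
  extensions X a []      = []
  extensions X a (δ ∷ v) = (X , a ++ δ ∷ []) ∷ extensions X (a ++ δ ∷ []) v

  extensions-last : ∀ X a δ v → (X , a ++ δ ∷ v) ∈ extensions X a (δ ∷ v)
  extensions-last X a δ []       = here refl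
  extensions-last X a δ (δ′ ∷ v) =
    there (subst (λ z → (X , z) ∈ extensions X (a ++ δ ∷ []) (δ′ ∷ v)) (++-assoc a (δ ∷ []) (δ′ ∷ v))
                 (extensions-last X (a ++ δ ∷ []) δ′ v))

  -- The fresh states ⟨X,v⟩, v non-empty, are the positions of the list Nodes.
  Nodes : List Pattern
  Nodes = concatMap (λ t → extensions (proj₁ t) [] (proj₂ t)) Patterns

  k : ℕ
  k = length Nodes

  State : Set
  State = P ⊎ Fin k

  decode : State → Pattern
  decode (inj₁ X) = (X , [])
  decode (inj₂ i) = lookup Nodes i

  -- encode t is the state standing for t (an arbitrary one if t is not named).
  encode : Pattern → State
  encode (X , [])    = inj₁ X
  encode (X , γ ∷ v) with (X , γ ∷ v) ∈? Nodes
  ... | yes m = inj₂ (index m)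
  ... | no _  = inj₁ X

  Named : Pattern → Set
  Named t = t ∈ Nodes ⊎ proj₂ t ≡ []

  decode-encode : ∀ {t} → Named t → decode (encode t) ≡ t
  decode-encode {X , []}    _         = refl
  decode-encode {X , γ ∷ v} (inj₂ ())
  decode-encode {X , γ ∷ v} (inj₁ t∈) with (X , γ ∷ v) ∈? Nodes
  ... | yes m = sym (lookup-index m)
  ... | no ∉  = ⊥-elim (∉ t∈)

  pattern-named : ∀ {t} → t ∈ Patterns → Named t
  pattern-named {X , []}    _  = inj₂ refl
  pattern-named {X , δ ∷ v} t∈ = inj₁ (∈-concatMap⁺ _ (lose t∈ (extensions-last X [] δ v)))

  patterns-named : ∀ {r} → r ∈ I₀ → All Named (patterns r)
  patterns-named r∈ = All.tabulate λ t∈ → pattern-named (∈-concatMap⁺ patterns (lose r∈ t∈))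

  push pop : P → Word S → S → Rule State S
  push X a δ = open-rule ((encode (X , a ++ δ ∷ []) , []) ∷ []) (encode (X , a)) (δ ∷ [])
  pop  X a δ = open-rule ((encode (X , a) , δ ∷ []) ∷ []) (encode (X , a ++ δ ∷ [])) []

  chain : P → Word S → Word S → APDS State S
  chain X a []      = []
  chain X a (δ ∷ v) = push X a δ ∷ pop X a δ ∷ chain X (a ++ δ ∷ []) v

  named : Pattern → State × Word S
  named t = (encode t , [])

  translate : Rule P S → Rule State S
  translate (open-rule prems Y w) = open-rule (map named prems) (encode (Y , w)) []
  translate (eps-rule Y)          = eps-rule (inj₁ Y)

  I : APDS State S
  I = map translate I₀ ++ concatMap (λ t → chain (proj₁ t) [] (proj₂ t)) Patterns

  translate∈I : ∀ {r} → r ∈ I₀ → translate r ∈ I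
  translate∈I r∈ = ++⁺ˡ (∈-map⁺ translate r∈)

  chain⊆I : ∀ {t} → t ∈ Patterns → chain (proj₁ t) [] (proj₂ t) ⊆ I
  chain⊆I t∈ ρ∈ = ++⁺ʳ (map translate I₀) (∈-concatMap⁺ _ (lose t∈ ρ∈))

  chain-small : ∀ X a v → SmallStep (chain X a v)
  chain-small X a []      = []
  chain-small X a (δ ∷ v) =
    inj₁ (intro-push (refl ∷ [])) ∷ inj₂ (inj₁ (elim [])) ∷ chain-small X (a ++ δ ∷ []) v

  translate-small : ∀ r → Introduction (translate r) ⊎ Elimination (translate r) ⊎ Neutral (translate r)
  translate-small (open-rule prems Y w) = inj₂ (inj₂ (neutral (All.map⁺ (All.tabulate λ _ → refl))))
  translate-small (eps-rule Y)          = inj₁ intro-eps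

  I-small : SmallStep I
  I-small = All.++⁺ (All.map⁺ (All.tabulate {xs = I₀} λ {r} _ → translate-small r))
                    (all-concatMap _ Patterns λ {t} _ → chain-small (proj₁ t) [] (proj₂ t))

  -- The intended model: ⟨X,v⟩(y) holds iff X(v y) is provable in I₀.
  ⟦_⟧ : State → Word S → Set
  ⟦ q ⟧ y = Provable I₀ (proj₁ (decode q) , proj₂ (decode q) ++ y)

  ⟦encode⟧ : ∀ {t} y → Named t → ⟦ encode t ⟧ y ≡ Provable I₀ (proj₁ t , proj₂ t ++ y)
  ⟦encode⟧ y n = cong (λ t → Provable I₀ (proj₁ t , proj₂ t ++ y)) (decode-encode n)

  ⟦shift⟧ : ∀ {X a} δ u → Named (X , a) → Named (X , a ++ δ ∷ []) →
            ⟦ encode (X , a) ⟧ (δ ∷ u) ≡ ⟦ encode (X , a ++ δ ∷ []) ⟧ u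
  ⟦shift⟧ {X} {a} δ u n n′ = begin
    ⟦ encode (X , a) ⟧ (δ ∷ u)               ≡⟨ ⟦encode⟧ (δ ∷ u) n ⟩
    Provable I₀ (X , a ++ δ ∷ u)             ≡⟨ cong (λ z → Provable I₀ (X , z)) (sym (++-assoc a (δ ∷ []) u)) ⟩
    Provable I₀ (X , (a ++ δ ∷ []) ++ u)     ≡⟨ sym (⟦encode⟧ u n′) ⟩
    ⟦ encode (X , a ++ δ ∷ []) ⟧ u           ∎
    where open ≡-Reasoning

  chain-closed : ∀ X a v → Named (X , a) → extensions X a v ⊆ Nodes → All (Closed ⟦_⟧) (chain X a v)
  chain-closed X a []      n sub = []
  chain-closed X a (δ ∷ v) n sub =
      (λ u → λ { (h ∷ []) → subst id (sym (⟦shift⟧ δ u n n′)) h })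
    ∷ (λ u → λ { (h ∷ []) → subst id (⟦shift⟧ δ u n n′) h })
    ∷ chain-closed X (a ++ δ ∷ []) v n′ (λ m → sub (there m))
    where
    n′ : Named (X , a ++ δ ∷ [])
    n′ = inj₁ (sub (here refl))

  -- The model is closed under a translated rule because I₀ is closed under the rule itself.
  translate-closed : ∀ {r} → r ∈ I₀ → Closed ⟦_⟧ (translate r)
  translate-closed {open-rule prems Y w} r∈ u hs with patterns-named r∈
  ... | nY ∷ nprems =
    subst id (sym (⟦encode⟧ u nY))
      (app-open r∈ u (All.zipWith (λ (n , h) → subst id (⟦encode⟧ u n) h) (nprems , All.map⁻ hs)))
  translate-closed {eps-rule Y} r∈ = app-eps r∈

  I-closed : All (Closed ⟦_⟧) I
  I-closed = All.++⁺ (All.map⁺ (All.tabulate {xs = I₀} translate-closed))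
                     (all-concatMap _ Patterns λ {t} t∈ →
                       chain-closed (proj₁ t) [] (proj₂ t) (inj₂ refl) (λ m → ∈-concatMap⁺ _ (lose t∈ m)))

  I-conservative : ∀ {X w} → Provable I (inj₁ X , w) → Provable I₀ (X , w)
  I-conservative = sound ⟦_⟧ I-closed

  module _ {H : List (State × Term S)} where
    pop-chain : ∀ X a v (t : Term S) → chain X a v ⊆ I →
                Deriv I H (encode (X , a) , (v , true) [ t ]) → Deriv I H (encode (X , a ++ v) , t)
    pop-chain X a []      t sub d = subst (λ z → Deriv I H (encode (X , z) , t)) (sym (++-identityʳ a)) d
    pop-chain X a (δ ∷ v) t sub d =
      subst (λ z → Deriv I H (encode (X , z) , t)) (++-assoc a (δ ∷ []) v)
        (pop-chain X (a ++ δ ∷ []) v t (λ m → sub (there (there m)))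
          (app-open (sub (there (here refl))) ((v , true) [ t ]) (d ∷ [])))

    push-chain : ∀ X a v (t : Term S) → chain X a v ⊆ I →
                 Deriv I H (encode (X , a ++ v) , t) → Deriv I H (encode (X , a) , (v , true) [ t ])
    push-chain X a []      t sub d = subst (λ z → Deriv I H (encode (X , z) , t)) (++-identityʳ a) d
    push-chain X a (δ ∷ v) t sub d =
      app-open (sub (here refl)) ((v , true) [ t ])
        (push-chain X (a ++ δ ∷ []) v t (λ m → sub (there (there m)))
          (subst (λ z → Deriv I H (encode (X , z) , t)) (sym (++-assoc a (δ ∷ []) v)) d) ∷ [])

  -- Each rule of I₀ is derivable: pop the premises' words into states, apply the
  -- translated neutral rule, and push the conclusion's word back onto the stack.
  translate-derivable : ∀ {r} → r ∈ I₀ → Derivable I (mapRule inj₁ r)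
  translate-derivable {open-rule prems Y w} r∈ =
    subst (λ z → Deriv I H (inj₁ Y , (z , true))) (++-identityʳ w)
      (push-chain Y [] w ([] , true) (chain⊆I (pattern∈ (here refl)))
        (app-open (translate∈I r∈) ([] , true) (All.map⁺ (All.tabulate premise))))
    where
    H : List (State × Term S)
    H = map (λ pv → (proj₁ pv , (proj₂ pv , true))) (map (λ pv → (inj₁ (proj₁ pv) , proj₂ pv)) prems)

    pattern∈ : ∀ {t} → t ∈ patterns (open-rule prems Y w) → t ∈ Patterns
    pattern∈ t∈ = ∈-concatMap⁺ patterns (lose r∈ t∈)

    premise : ∀ {t} → t ∈ prems → Deriv I H (encode t , ([] , true))
    premise {X , v} t∈ =
      pop-chain X [] v ([] , true) (chain⊆I (pattern∈ (there t∈)))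
        (subst (λ z → Deriv I H (inj₁ X , (z , true))) (sym (++-identityʳ v))
          (hyp (∈-map⁺ _ (∈-map⁺ _ t∈))))
  translate-derivable {eps-rule Y} r∈ = app-eps (translate∈I r∈)

lemma2 : ∀ {p s : ℕ} (I₀ : APDS (Fin p) (Fin s)) →
    Σ ℕ λ k → Σ (APDS (Fin p ⊎ Fin k) (Fin s)) λ I →
      SmallStep I
      × All (λ r → Derivable I (mapRule inj₁ r)) I₀
      × (∀ (P : Fin p) (w : List (Fin s)) → Provable I (inj₁ P , w) ⇔ Provable I₀ (P , w))
lemma2 I₀ =
  k , I , I-small , derivable ,
  λ X w → mk⇔ I-conservative (derivable⇒admissible inj₁ derivable)
  where
  open SmallStepTranslation _≟Fin_ _≟Fin_ I₀
  derivable : All (λ r → Derivable I (mapRule inj₁ r)) I₀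
  derivable = All.tabulate translate-derivable
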